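{- Let $\bar\pi^*$ be an optimal solution of $\min\{\|W_-^{ -1}A^T\bar\pi\|_\infty: b^T\bar\pi=1\}$ and let $\bar\pi$ be a feasible solution of that problem with $\|W_-^{ -1}A^T\bar\pi\|_\infty\le\alpha\,\|W_-^{ -1}A^T\bar\pi^*\|_\infty$. Then $\bar\pi$ is feasible for $\min\{q(R_*A^T\pi): b^T\pi=1\}$, and $q(R_*A^T\bar\pi)\le\alpha\lambda\, q(R_*A^T\pi^*)$, where $\pi^*$ is an optimal solution of $\min\{q(R_*A^T\pi): b^T\pi=1\}$.
   Context: $G=(V,E)$ is a connected undirected graph with $n$ nodes, $m$ edges, positive integer weights $w^+,w^-\in\mathbb{Z}_{\ge1}^m$, demand vector $b\in\mathbb{Z}^n$. Each edge is oriented $(u,v)$ with $w^+\ge w^-$ on it. $A\in\mathbb{R}^{n\times m}$ is the node-arc incidence matrix for this orientation (column of $(u,v)$ has $+1$ at $v$, $-1$ at $u$). $W_\pm=\mathrm{diag}(w^\pm)$, $R_*=[W_+^{ -1}\;\;-W_-^{ -1}]^T\in\mathbb{R}^{2m\times m}$. For $v\in\mathbb{R}^d$, $q(v)=\max\{0,\max_i v_i\}$. $\lambda:=\|W_-^{ -1}w^+\|_\infty\ge1$. $\alpha\ge1$.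
   Formalization: The vectors $\bar\pi^*$, $\bar\pi$, $\pi^*$ have rational entries, $\alpha$ is rational, and both minimisation problems are taken over vectors with rational entries. -}

module Defs where

open import Data.Nat as ℕ using (ℕ; zero; suc)
open import Data.Integer as ℤ using (ℤ; +_)
open import Data.Rational using (ℚ; 0ℚ; _+_; _*_; -_; _/_; _⊔_; ∣_∣)
open import Data.Fin using (Fin; splitAt)
open import Data.Sum using (inj₁; inj₂)
open import Data.Product using (_×_; proj₁; proj₂)
open import Relation.Binary.PropositionalEquality using (_≡_)

record Graph (n m : ℕ) : Set where
  field
    tail : Fin m → Fin n
    head : Fin m → Fin n
open Graph public

data Reach {n m : ℕ} (G : Graph n m) : Fin n → Fin n → Set where
  here : ∀ {u} → Reach G u u
  fwd  : ∀ {u} e → Reach G (head G e) u → Reach G (tail G e) u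
  bwd  : ∀ {u} e → Reach G (tail G e) u → Reach G (head G e) u

Connected : {n m : ℕ} → Graph n m → Set
Connected {n} G = (u v : Fin n) → Reach G u v

sumℚ : ∀ {d} → (Fin d → ℚ) → ℚ
sumℚ {zero}  v = 0ℚ
sumℚ {suc d} v = v Fin.zero + sumℚ (λ i → v (Fin.suc i))
  where import Data.Fin as Fin

q : ∀ {d} → (Fin d → ℚ) → ℚ
q {zero}  v = 0ℚ
q {suc d} v = v Fin.zero ⊔ q (λ i → v (Fin.suc i))
  where import Data.Fin as Fin

‖_‖∞ : ∀ {d} → (Fin d → ℚ) → ℚ
‖ v ‖∞ = q (λ i → ∣ v i ∣)

-- x / k for a positive natural k (the value at k = 0 is an unused convention)
_/ℕ_ : ℚ → ℕ → ℚ
x /ℕ zero    = 0ℚ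
x /ℕ (suc k) = x * (+ 1 / suc k)

ℤ→ℚ : ℤ → ℚ
ℤ→ℚ z = z / 1

-- (A^T π)_e = π_head(e) − π_tail(e)   (column of (u,v): +1 at v, −1 at u)
Aᵀ : ∀ {n m} → Graph n m → (Fin n → ℚ) → (Fin m → ℚ)
Aᵀ G π e = π (head G e) + (- π (tail G e))

dotℤ : ∀ {n} → (Fin n → ℤ) → (Fin n → ℚ) → ℚ
dotℤ b π = sumℚ (λ i → ℤ→ℚ (b i) * π i)

Winv : ∀ {m} → (Fin m → ℕ) → (Fin m → ℚ) → (Fin m → ℚ)
Winv w y e = y e /ℕ w e

-- R_* y = [W_+^{-1} y ; −W_-^{-1} y]  ∈ ℚ^{m+m}
Rstar : ∀ {m} → (w⁺ w⁻ : Fin m → ℕ) → (Fin m → ℚ) → (Fin (m ℕ.+ m) → ℚ)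
Rstar {m} w⁺ w⁻ y i with splitAt m i
... | inj₁ e = y e /ℕ w⁺ e
... | inj₂ e = - (y e /ℕ w⁻ e)

lam : ∀ {m} → (w⁺ w⁻ : Fin m → ℕ) → ℚ
lam w⁺ w⁻ = ‖ Winv w⁻ (λ e → ℤ→ℚ (+ w⁺ e)) ‖∞

f∞ : ∀ {n m} → Graph n m → (w⁻ : Fin m → ℕ) → (Fin n → ℚ) → ℚ
f∞ G w⁻ π = ‖ Winv w⁻ (Aᵀ G π) ‖∞

fq : ∀ {n m} → Graph n m → (w⁺ w⁻ : Fin m → ℕ) → (Fin n → ℚ) → ℚ
fq G w⁺ w⁻ π = q (Rstar w⁺ w⁻ (Aᵀ G π))

Feasible : ∀ {n} → (Fin n → ℤ) → (Fin n → ℚ) → Set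
Feasible b π = dotℤ b π ≡ ℤ→ℚ (+ 1)

Optimal : ∀ {n} → (Fin n → ℤ) → ((Fin n → ℚ) → ℚ) → (Fin n → ℚ) → Set
Optimal {n} b f π = Feasible b π × ((π' : Fin n → ℚ) → Feasible b π' → f π Data.Rational.≤ f π')
  where import Data.Rational

-- The two objectives are equivalent up to the factor λ, edge by edge.  With a = w⁻ₑ ≤ b = w⁺ₑ and
-- y = (Aᵀπ)ₑ, the entries of R_* Aᵀπ at e are y/b and −y/a, both bounded by |y/a|, so
-- q(R_* Aᵀπ) ≤ ‖W₋⁻¹Aᵀπ‖∞.  Conversely y/a = (b/a)(y/b) with 1 ≤ b/a ≤ λ, so both y/a and −y/a
-- are at most λ·q(R_* Aᵀπ).  Chaining these through the α-approximation and the optimality of π̄*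
-- against the feasible point π* gives
--   q(R_* Aᵀπ̄) ≤ ‖W₋⁻¹Aᵀπ̄‖∞ ≤ α‖W₋⁻¹Aᵀπ̄*‖∞ ≤ α‖W₋⁻¹Aᵀπ*‖∞ ≤ αλ q(R_* Aᵀπ*).
module Submission where

open import Defs
open import Data.Nat as ℕ using (ℕ; zero; suc; s≤s; z≤n)
open import Data.Integer as ℤ using (ℤ; +_)
import Data.Integer.Properties as ℤ
import Data.Nat.Properties as ℕ
open import Data.Rational using (ℚ; 0ℚ; 1ℚ; mkℚ; *≤*; nonNegative; _≤_; _*_; -_; _/_; ∣_∣)
open import Data.Rational.Properties
open import Data.Rational.Solver using (module +-*-Solver)
import Data.Nat.Coprimality as Coprimality
open import Data.Fin using (Fin; zero; suc; _↑ˡ_; _↑ʳ_; splitAt)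
open import Data.Fin.Properties using (splitAt-↑ˡ; splitAt-↑ʳ)
open import Data.Sum using (inj₁; inj₂)
open import Data.Product using (_×_; _,_)
open import Relation.Binary.PropositionalEquality using (_≡_; refl; sym; trans; cong; subst; subst₂; module ≡-Reasoning)

*-monoˡ-≤-0≤ : ∀ r → 0ℚ ≤ r → ∀ {p p′} → p ≤ p′ → r * p ≤ r * p′
*-monoˡ-≤-0≤ r 0≤r = *-monoˡ-≤-nonNeg r {{nonNegative 0≤r}}

*-monoʳ-≤-0≤ : ∀ r → 0ℚ ≤ r → ∀ {p p′} → p ≤ p′ → p * r ≤ p′ * r
*-monoʳ-≤-0≤ r 0≤r = *-monoʳ-≤-nonNeg r {{nonNegative 0≤r}}

0≤*-0≤ : ∀ {p r} → 0ℚ ≤ p → 0ℚ ≤ r → 0ℚ ≤ p * r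
0≤*-0≤ {p} {r} 0≤p 0≤r = subst (_≤ p * r) (*-zeroʳ p) (*-monoˡ-≤-0≤ p 0≤p 0≤r)

1≤⇒0≤ : ∀ {p} → 1ℚ ≤ p → 0ℚ ≤ p
1≤⇒0≤ = ≤-trans (*≤* (ℤ.+≤+ z≤n))

p≤∣p∣ : ∀ p → p ≤ ∣ p ∣
p≤∣p∣ p with ≤-total 0ℚ p
... | inj₁ 0≤p = ≤-reflexive (sym (0≤p⇒∣p∣≡p 0≤p))
... | inj₂ p≤0 = ≤-trans p≤0 (0≤∣p∣ p)

-p≤∣p∣ : ∀ p → - p ≤ ∣ p ∣
-p≤∣p∣ p = subst (- p ≤_) (∣-p∣≡∣p∣ p) (p≤∣p∣ (- p))

∣p∣≤ : ∀ {p r} → p ≤ r → - p ≤ r → ∣ p ∣ ≤ r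
∣p∣≤ {p} p≤r -p≤r with ∣p∣≡p∨∣p∣≡-p p
... | inj₁ ∣p∣≡p  = subst (_≤ _) (sym ∣p∣≡p) p≤r
... | inj₂ ∣p∣≡-p = subst (_≤ _) (sym ∣p∣≡-p) -p≤r

0≤q : ∀ {d} (v : Fin d → ℚ) → 0ℚ ≤ q v
0≤q {zero}  v = ≤-refl
0≤q {suc d} v = ≤-trans (0≤q (λ i → v (suc i))) (p≤q⊔p (v zero) _)

vᵢ≤q : ∀ {d} (v : Fin d → ℚ) i → v i ≤ q v
vᵢ≤q {suc d} v zero    = p≤p⊔q _ _
vᵢ≤q {suc d} v (suc i) = ≤-trans (vᵢ≤q (λ j → v (suc j)) i) (p≤q⊔p (v zero) _)

q-lub : ∀ {d} (v : Fin d → ℚ) {r} → 0ℚ ≤ r → (∀ i → v i ≤ r) → q v ≤ r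
q-lub {zero}  v 0≤r vᵢ≤r = 0≤r
q-lub {suc d} v 0≤r vᵢ≤r = ⊔-lub (vᵢ≤r zero) (q-lub (λ i → v (suc i)) 0≤r (λ i → vᵢ≤r (suc i)))

1/suc : ℕ → ℚ
1/suc k = + 1 / suc k

1/suc≡mkℚ : ∀ k → 1/suc k ≡ mkℚ (+ 1) k (Coprimality.1-coprimeTo (suc k))
1/suc≡mkℚ k = normalize-coprime (Coprimality.1-coprimeTo (suc k))

suc≡mkℚ : ∀ k → ℤ→ℚ (+ suc k) ≡ mkℚ (+ suc k) 0 (Coprimality.sym (Coprimality.1-coprimeTo (suc k)))
suc≡mkℚ k = normalize-coprime (Coprimality.sym (Coprimality.1-coprimeTo (suc k)))

0≤1/suc : ∀ k → 0ℚ ≤ 1/suc k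
0≤1/suc k rewrite 1/suc≡mkℚ k = *≤* (ℤ.+≤+ z≤n)

1/suc-antimono : ∀ {j k} → j ℕ.≤ k → 1/suc k ≤ 1/suc j
1/suc-antimono {j} {k} j≤k rewrite 1/suc≡mkℚ j | 1/suc≡mkℚ k =
  *≤* (subst₂ ℤ._≤_ (sym (ℤ.*-identityˡ (+ suc j))) (sym (ℤ.*-identityˡ (+ suc k))) (ℤ.+≤+ (s≤s j≤k)))

suc*1/suc≡1 : ∀ k → ℤ→ℚ (+ suc k) * 1/suc k ≡ 1ℚ
suc*1/suc≡1 k rewrite 1/suc≡mkℚ k | suc≡mkℚ k = *-inverseʳ (mkℚ (+ suc k) 0 (Coprimality.sym (Coprimality.1-coprimeTo (suc k))))

∣/ℕ∣-antimono : ∀ y {a b} → 1 ℕ.≤ a → a ℕ.≤ b → ∣ y /ℕ b ∣ ≤ ∣ y /ℕ a ∣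
∣/ℕ∣-antimono y {suc j} {suc k} _ (s≤s j≤k) = begin
  ∣ y * 1/suc k ∣   ≡⟨ ∣y*1/suc∣ k ⟩
  ∣ y ∣ * 1/suc k   ≤⟨ *-monoˡ-≤-0≤ ∣ y ∣ (0≤∣p∣ y) (1/suc-antimono j≤k) ⟩
  ∣ y ∣ * 1/suc j   ≡⟨ ∣y*1/suc∣ j ⟨
  ∣ y * 1/suc j ∣   ∎
  where
  open ≤-Reasoning
  ∣y*1/suc∣ : ∀ i → ∣ y * 1/suc i ∣ ≡ ∣ y ∣ * 1/suc i
  ∣y*1/suc∣ i = trans (∣p*q∣≡∣p∣*∣q∣ y (1/suc i)) (cong (∣ y ∣ *_) (0≤p⇒∣p∣≡p (0≤1/suc i)))

/ℕ-rescale : ∀ y {a b} → 1 ℕ.≤ a → 1 ℕ.≤ b → y /ℕ a ≡ (ℤ→ℚ (+ b) /ℕ a) * (y /ℕ b)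
/ℕ-rescale y {suc j} {suc k} _ _ = sym (begin
  (B * 1/suc j) * (y * 1/suc k)   ≡⟨ swap B (1/suc j) y (1/suc k) ⟩
  (y * 1/suc j) * (B * 1/suc k)   ≡⟨ cong ((y * 1/suc j) *_) (suc*1/suc≡1 k) ⟩
  (y * 1/suc j) * 1ℚ              ≡⟨ *-identityʳ _ ⟩
  y * 1/suc j                     ∎)
  where
  open ≡-Reasoning
  open +-*-Solver
  B : ℚ
  B = ℤ→ℚ (+ suc k)
  swap : ∀ p r s t → (p * r) * (s * t) ≡ (s * r) * (p * t)
  swap = solve 4 (λ p r s t → (p :* r) :* (s :* t) := (s :* r) :* (p :* t)) refl

1≤/ℕ : ∀ {a b} → 1 ℕ.≤ a → a ℕ.≤ b → 1ℚ ≤ ℤ→ℚ (+ b) /ℕ a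
1≤/ℕ {suc j} {suc k} _ (s≤s j≤k) = begin
  1ℚ                          ≡⟨ suc*1/suc≡1 k ⟨
  ℤ→ℚ (+ suc k) * 1/suc k     ≤⟨ *-monoˡ-≤-0≤ _ 0≤suc (1/suc-antimono j≤k) ⟩
  ℤ→ℚ (+ suc k) * 1/suc j     ∎
  where
  open ≤-Reasoning
  0≤suc : 0ℚ ≤ ℤ→ℚ (+ suc k)
  0≤suc rewrite suc≡mkℚ k = *≤* (ℤ.+≤+ z≤n)

module _ {m : ℕ} (w⁺ w⁻ : Fin m → ℕ)
         (1≤w⁻ : ∀ e → 1 ℕ.≤ w⁻ e) (w⁻≤w⁺ : ∀ e → w⁻ e ℕ.≤ w⁺ e) where

  Rstar-↑ˡ : ∀ y e → Rstar w⁺ w⁻ y (e ↑ˡ m) ≡ y e /ℕ w⁺ e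
  Rstar-↑ˡ y e rewrite splitAt-↑ˡ m e m = refl

  Rstar-↑ʳ : ∀ y e → Rstar w⁺ w⁻ y (m ↑ʳ e) ≡ - (y e /ℕ w⁻ e)
  Rstar-↑ʳ y e rewrite splitAt-↑ʳ m m e = refl

  q-Rstar≤‖Winv‖∞ : ∀ y → q (Rstar w⁺ w⁻ y) ≤ ‖ Winv w⁻ y ‖∞
  q-Rstar≤‖Winv‖∞ y = q-lub (Rstar w⁺ w⁻ y) (0≤q (λ e → ∣ Winv w⁻ y e ∣)) entry≤
    where
    ∣y/w⁻∣≤‖Winv‖∞ : ∀ e → ∣ y e /ℕ w⁻ e ∣ ≤ ‖ Winv w⁻ y ‖∞
    ∣y/w⁻∣≤‖Winv‖∞ = vᵢ≤q (λ e → ∣ Winv w⁻ y e ∣)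
    entry≤ : ∀ i → Rstar w⁺ w⁻ y i ≤ ‖ Winv w⁻ y ‖∞
    entry≤ i with splitAt m i
    ... | inj₁ e = ≤-trans (≤-trans (p≤∣p∣ _) (∣/ℕ∣-antimono (y e) (1≤w⁻ e) (w⁻≤w⁺ e))) (∣y/w⁻∣≤‖Winv‖∞ e)
    ... | inj₂ e = ≤-trans (-p≤∣p∣ _) (∣y/w⁻∣≤‖Winv‖∞ e)

  ‖Winv‖∞≤lam*q-Rstar : ∀ y → ‖ Winv w⁻ y ‖∞ ≤ lam w⁺ w⁻ * q (Rstar w⁺ w⁻ y)
  ‖Winv‖∞≤lam*q-Rstar y =
    q-lub (λ e → ∣ Winv w⁻ y e ∣) (0≤*-0≤ (0≤q (λ e → ∣ κ e ∣)) 0≤F) (λ e → ∣p∣≤ (y/w⁻≤ΛF e) (-y/w⁻≤ΛF e))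
    where
    Λ F : ℚ
    Λ = lam w⁺ w⁻
    F = q (Rstar w⁺ w⁻ y)
    κ : Fin m → ℚ
    κ e = ℤ→ℚ (+ w⁺ e) /ℕ w⁻ e
    0≤F : 0ℚ ≤ F
    0≤F = 0≤q (Rstar w⁺ w⁻ y)
    1≤κ : ∀ e → 1ℚ ≤ κ e
    1≤κ e = 1≤/ℕ (1≤w⁻ e) (w⁻≤w⁺ e)
    κF≤ΛF : ∀ e → κ e * F ≤ Λ * F
    κF≤ΛF e = *-monoʳ-≤-0≤ F 0≤F (≤-trans (p≤∣p∣ (κ e)) (vᵢ≤q (λ e → ∣ κ e ∣) e))
    y/w⁻≤ΛF : ∀ e → y e /ℕ w⁻ e ≤ Λ * F
    y/w⁻≤ΛF e = begin
      y e /ℕ w⁻ e          ≡⟨ /ℕ-rescale (y e) (1≤w⁻ e) (ℕ.≤-trans (1≤w⁻ e) (w⁻≤w⁺ e)) ⟩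
      κ e * (y e /ℕ w⁺ e)  ≤⟨ *-monoˡ-≤-0≤ (κ e) (1≤⇒0≤ (1≤κ e)) y/w⁺≤F ⟩
      κ e * F              ≤⟨ κF≤ΛF e ⟩
      Λ * F                ∎
      where
      open ≤-Reasoning
      y/w⁺≤F : y e /ℕ w⁺ e ≤ F
      y/w⁺≤F = subst (_≤ F) (Rstar-↑ˡ y e) (vᵢ≤q (Rstar w⁺ w⁻ y) (e ↑ˡ m))
    -y/w⁻≤ΛF : ∀ e → - (y e /ℕ w⁻ e) ≤ Λ * F
    -y/w⁻≤ΛF e = begin
      - (y e /ℕ w⁻ e)         ≡⟨ Rstar-↑ʳ y e ⟨
      Rstar w⁺ w⁻ y (m ↑ʳ e)  ≤⟨ vᵢ≤q (Rstar w⁺ w⁻ y) (m ↑ʳ e) ⟩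
      F                       ≡⟨ *-identityˡ F ⟨
      1ℚ * F                  ≤⟨ *-monoʳ-≤-0≤ F 0≤F (1≤κ e) ⟩
      κ e * F                 ≤⟨ κF≤ΛF e ⟩
      Λ * F                   ∎
      where open ≤-Reasoning

mainTheorem7 : (n m : ℕ) (G : Graph n m) → Connected G
    → (w⁺ w⁻ : Fin m → ℕ)
    → ((e : Fin m) → 1 ℕ.≤ w⁻ e) → ((e : Fin m) → 1 ℕ.≤ w⁺ e)
    → ((e : Fin m) → w⁻ e ℕ.≤ w⁺ e)
    → (b : Fin n → ℤ) (α : ℚ) → 1ℚ ≤ α
    → (πbar* πbar π* : Fin n → ℚ)
    → Optimal b (f∞ G w⁻) πbar*
    → Feasible b πbar
    → f∞ G w⁻ πbar ≤ α * f∞ G w⁻ πbar*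
    → Optimal b (fq G w⁺ w⁻) π*
    → Feasible b πbar × (fq G w⁺ w⁻ πbar ≤ (α * lam w⁺ w⁻) * fq G w⁺ w⁻ π*)
mainTheorem7 n m G _ w⁺ w⁻ 1≤w⁻ _ w⁻≤w⁺ b α 1≤α π̄* π̄ π* (_ , π̄*-optimal) π̄-feasible π̄-approx (π*-feasible , _) =
  π̄-feasible , (begin
    fq G w⁺ w⁻ π̄           ≤⟨ q-Rstar≤‖Winv‖∞ w⁺ w⁻ 1≤w⁻ w⁻≤w⁺ (Aᵀ G π̄) ⟩
    f∞ G w⁻ π̄              ≤⟨ π̄-approx ⟩
    α * f∞ G w⁻ π̄*         ≤⟨ *-monoˡ-≤-0≤ α 0≤α (π̄*-optimal π* π*-feasible) ⟩
    α * f∞ G w⁻ π*         ≤⟨ *-monoˡ-≤-0≤ α 0≤α (‖Winv‖∞≤lam*q-Rstar w⁺ w⁻ 1≤w⁻ w⁻≤w⁺ (Aᵀ G π*)) ⟩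
    α * (Λ * fq G w⁺ w⁻ π*) ≡⟨ *-assoc α Λ _ ⟨
    (α * Λ) * fq G w⁺ w⁻ π* ∎)
  where
  open ≤-Reasoning
  Λ : ℚ
  Λ = lam w⁺ w⁻
  0≤α : 0ℚ ≤ α
  0≤α = 1≤⇒0≤ 1≤α
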